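{- There exists an infinite sequence of graphs $\{G_n\}_{n=3}^{\infty}$ such that for each $n\ge 3$, $\Gamma(G_n)=\mathrm{b}(G_n)=2n-1$ but $z(G_n)=\chi(G_n)=n$.
   Context: All graphs are finite, undirected, without loops or multiple edges. $\chi(G)$ is the chromatic number. A Grundy-coloring of $G$ is a proper vertex coloring with color classes $C_1,\ldots,C_k$ such that for every $i<j$, every vertex in $C_j$ has a neighbor in $C_i$; the Grundy number $\Gamma(G)$ is the maximum number of colors in a Grundy-coloring of $G$. A b-coloring of $G$ is a proper vertex coloring in which every color class contains a vertex adjacent to at least one vertex of every other color class; the b-chromatic number $\mathrm{b}(G)$ is the largest $k$ such that $G$ has a b-coloring with $k$ colors. A $z$-coloring of a graph $G$ is a proper vertex coloring with (nonempty) color classes $C_1,\ldots,C_k$ such that: (i) for any $1\le i<j\le k$, every vertex of color $j$ is adjacent to a vertex of color $i$; (ii) there is a set $\{u_1,\ldots,u_k\}$ of vertices with $u_j\in C_j$ for each $j$, such that $u_k$ is adjacent to $u_j$ for every $j\ne k$; and (iii) for all $i\ne j$, the vertex $u_j$ has a neighbor in $C_i$. $z(G)$ denotes the maximum number of colors used in a $z$-coloring of $G$. -}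

module Defs where

open import Level using (0ℓ)
open import Data.Nat using (ℕ; suc; _≤_)
open import Data.Fin using (Fin; fromℕ) renaming (_<_ to _<ᶠ_)
open import Data.Product using (Σ; _×_; ∃; ∃-syntax)
open import Relation.Binary.PropositionalEquality using (_≡_; _≢_)
open import Relation.Nullary using (¬_)
open import Function.Definitions using (Surjective)

record Graph : Set₁ where
  field
    V      : ℕ
    E      : Fin V → Fin V → Set
    sym    : ∀ {u v} → E u v → E v u
    irrefl : ∀ {v} → ¬ E v v
open Graph public

record Coloring (G : Graph) (k : ℕ) : Set where
  field
    col    : Fin (V G) → Fin k
    proper : ∀ {u v} → E G u v → col u ≢ col v
    onto   : Surjective _≡_ _≡_ col
open Coloring public

GrundyCond : (G : Graph) {k : ℕ} → Coloring G k → Set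
GrundyCond G c = ∀ (i j : Fin _) → i <ᶠ j → ∀ v → col c v ≡ j →
  ∃[ u ] (E G v u × col c u ≡ i)

IsGrundyColoring : (G : Graph) {k : ℕ} → Coloring G k → Set
IsGrundyColoring G c = GrundyCond G c

IsBColoring : (G : Graph) {k : ℕ} → Coloring G k → Set
IsBColoring G {k} c = ∀ (i : Fin k) → ∃[ v ] (col c v ≡ i ×
  (∀ (j : Fin k) → j ≢ i → ∃[ u ] (E G v u × col c u ≡ j)))

IsZColoring : (G : Graph) {m : ℕ} → Coloring G (suc m) → Set
IsZColoring G {m} c = GrundyCond G c ×
  Σ (Fin (suc m) → Fin (V G)) λ u →
    (∀ j → col c (u j) ≡ j) ×
    (∀ j → j ≢ fromℕ m → E G (u (fromℕ m)) (u j)) ×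
    (∀ i j → i ≢ j → ∃[ w ] (E G (u j) w × col c w ≡ i))

HasProperColoring : Graph → ℕ → Set
HasProperColoring G k = Coloring G k

HasGrundyColoring : Graph → ℕ → Set
HasGrundyColoring G k = Σ (Coloring G k) (IsGrundyColoring G)

HasBColoring : Graph → ℕ → Set
HasBColoring G k = Σ (Coloring G k) (IsBColoring G)

HasZColoring : Graph → ℕ → Set
HasZColoring G 0       = Data.Empty.⊥  where import Data.Empty
HasZColoring G (suc m) = Σ (Coloring G (suc m)) (IsZColoring G)

IsMax : (ℕ → Set) → ℕ → Set
IsMax P n = P n × (∀ k → P k → k ≤ n)

IsMin : (ℕ → Set) → ℕ → Set
IsMin P n = P n × (∀ k → P k → n ≤ k)

χ≡ : Graph → ℕ → Set
χ≡ G = IsMin (HasProperColoring G)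

Γ≡ : Graph → ℕ → Set
Γ≡ G = IsMax (HasGrundyColoring G)

b≡ : Graph → ℕ → Set
b≡ G = IsMax (HasBColoring G)

z≡ : Graph → ℕ → Set
z≡ G = IsMax (HasZColoring G)

-- For 2 ≤ n ≤ D ≤ 2n − 2 take G = K_n ⊎ B_D ⊎ (D + 1)·K_{1,D}, with B_D the binomial tree of
-- depth D. Its maximum degree is D, so Γ(G), b(G) ≤ D + 1, and both bounds are attained: colouring
-- a tree vertex by its number of leading zeros is a Grundy colouring with D + 1 colours, and giving
-- the leaves of the c-th star every colour but c makes its centre a b-vertex of colour c.
-- K_n forces χ(G) ≥ n, and colouring the bipartite rest with two of the clique's colours is a
-- z-colouring with n colours. Conversely, the top vertex of a z-colouring with more than n colours
-- has degree ≥ n and n neighbours of degree ≥ n. No vertex of G is like that: a tree vertex of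
-- degree ≥ n has at least n − 1 leading zeros, and its neighbours of degree ≥ n differ from it in
-- one of the last D − n + 1 < n bit positions.

module Submission where

open import Defs
open import Data.Nat using (ℕ; _≤_; _*_; _∸_)
open import Data.Product using (Σ; _×_)
open import Data.Bool using (Bool; true; false; not; _xor_)
open import Data.Bool.Properties using (not-¬; not-involutive)
open import Data.Empty using (⊥-elim)
open import Data.Fin using (Fin; zero; suc; toℕ; fromℕ; fromℕ<; inject₁; inject≤; punchIn; punchOut; _≟_)
open import Data.Fin.Properties
  using ( suc-injective; toℕ-injective; toℕ<n; toℕ-fromℕ<; toℕ-inject≤; inject₁-injective; inject≤-injective
        ; punchIn-injective; punchInᵢ≢i; punchOut-injective; punchIn-punchOut; ≤fromℕ; fromℕ≢inject₁; ≤∧≢⇒<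
        ; injective⇒≤; +↔⊎; *↔×; 2↔Bool )
open import Data.Nat using (zero; suc; _+_; _^_; _<_; z≤n; s≤s; s≤s⁻¹; _≤?_; _<?_)
open import Data.Nat.Properties
  using ( ≤-refl; ≤-reflexive; ≤-trans; <-trans; <-≤-trans; <⇒≢; ≰⇒>; ≮⇒≥; <⇒≱; 1+n≰n; m≤m+n; m≤n⇒m≤1+n
        ; ∸-monoˡ-<; ∸-cancelʳ-≡; m≤n+o⇒m∸n≤o; +-suc; +-identityʳ )
open import Data.Product using (_,_; ∃-syntax; proj₁; proj₂; uncurry)
open import Data.Product.Function.NonDependent.Propositional using (_×-↔_)
open import Data.Sum using (_⊎_; inj₁; inj₂)
open import Data.Sum.Function.Propositional using (_⊎-↔_)
open import Data.Vec using (Vec; []; _∷_; uncons)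
open import Function using (_∘_; id)
open import Function.Bundles using (Inverse; _↔_; mk↔ₛ′)
open import Function.Definitions using (Injective)
open import Function.Properties.Inverse using (↔-refl; ↔-trans)
open import Relation.Binary.PropositionalEquality as ≡ using (_≡_; _≢_; refl; trans; cong; subst; module ≡-Reasoning)
open import Relation.Nullary using (¬_; yes; no)

private variable
  d m k r : ℕ

interval-injective⇒≤ : ∀ {a b} (f : Fin r → ℕ) → Injective _≡_ _≡_ f →
  (∀ i → a ≤ f i × f i < b) → r ≤ b ∸ a
interval-injective⇒≤ {a = a} f f-inj range = injective⇒≤ shifted-injective
  where
  shifted : Fin _ → Fin _
  shifted i = fromℕ< (∸-monoˡ-< (proj₂ (range i)) (proj₁ (range i)))
  shifted-injective : Injective _≡_ _≡_ shifted
  shifted-injective {i} {j} eq = f-inj (∸-cancelʳ-≡ (proj₁ (range i)) (proj₁ (range j)) (begin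
    f i ∸ a             ≡⟨ ≡.sym (toℕ-fromℕ< _) ⟩
    toℕ (shifted i)     ≡⟨ cong toℕ eq ⟩
    toℕ (shifted j)     ≡⟨ toℕ-fromℕ< _ ⟩
    f j ∸ a             ∎))
    where open ≡-Reasoning

record DegreeAtLeast {X : Set} (R : X → X → Set) (r : ℕ) (x : X) : Set where
  constructor neighbours
  field
    neighbour           : Fin r → X
    neighbour-injective : Injective _≡_ _≡_ neighbour
    adjacent            : ∀ i → R x (neighbour i)

MaxDegreeAtMost : {X : Set} → (X → X → Set) → ℕ → Set
MaxDegreeAtMost R Δ = ∀ {r} x → DegreeAtLeast R r x → r ≤ Δ

DenseStar : {X : Set} → (X → X → Set) → ℕ → X → Set
DenseStar R k x = DegreeAtLeast R k x × DegreeAtLeast (λ y z → R y z × DegreeAtLeast R k z) k x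

DenseStarFree : {X : Set} → (X → X → Set) → ℕ → Set
DenseStarFree R k = ∀ x → ¬ DenseStar R k x

DegreeAtLeast-map : ∀ {X Y} {R : X → X → Set} {S : Y → Y → Set} (f : X → Y) → Injective _≡_ _≡_ f →
  (∀ {x y} → R x y → S (f x) (f y)) → ∀ {x} → DegreeAtLeast R r x → DegreeAtLeast S r (f x)
DegreeAtLeast-map f f-injective f-hom (neighbours g g-injective adj) =
  neighbours (f ∘ g) (g-injective ∘ f-injective) (f-hom ∘ adj)

DegreeAtLeast-weaken : ∀ {X} {R : X → X → Set} {x} → k ≤ r → DegreeAtLeast R r x → DegreeAtLeast R k x
DegreeAtLeast-weaken k≤r (neighbours g g-injective adj) =
  neighbours (λ i → g (inject≤ i k≤r)) (inject≤-injective _ _ _ _ ∘ g-injective) (λ i → adj (inject≤ i k≤r))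

DenseStar-map : ∀ {X Y} {R : X → X → Set} {S : Y → Y → Set} (f : X → Y) → Injective _≡_ _≡_ f →
  (∀ {x y} → R x y → S (f x) (f y)) → ∀ {x} → DenseStar R k x → DenseStar S k (f x)
DenseStar-map f f-injective f-hom (degree , dense) =
  DegreeAtLeast-map f f-injective f-hom degree ,
  DegreeAtLeast-map f f-injective (λ (e , degree-y) → f-hom e , DegreeAtLeast-map f f-injective f-hom degree-y) dense

DenseStar-weaken : ∀ {X} {R : X → X → Set} {x} → k ≤ r → DenseStar R r x → DenseStar R k x
DenseStar-weaken k≤r (degree , dense) =
  DegreeAtLeast-weaken k≤r degree ,
  DegreeAtLeast-weaken k≤r (DegreeAtLeast-map id id (λ (e , degree-y) → e , DegreeAtLeast-weaken k≤r degree-y) dense)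

labels⇒degree≤ : ∀ {X} {R : X → X → Set} {x a b} (ℓ : ∀ {y} → R x y → ℕ) →
  (∀ {y y′} (e : R x y) (e′ : R x y′) → ℓ e ≡ ℓ e′ → y ≡ y′) →
  (∀ {y} (e : R x y) → a ≤ ℓ e × ℓ e < b) → DegreeAtLeast R r x → r ≤ b ∸ a
labels⇒degree≤ ℓ ℓ-injective range (neighbours g g-injective adj) =
  interval-injective⇒≤ (ℓ ∘ adj) (g-injective ∘ ℓ-injective (adj _) (adj _)) (range ∘ adj)

colourful⇒degree≥ : ∀ {X C : Set} {R : X → X → Set} (c : X → C) (φ : Fin r → C) → Injective _≡_ _≡_ φ →
  ∀ {x} → (∀ i → ∃[ y ] (R x y × c y ≡ φ i)) → DegreeAtLeast R r x
colourful⇒degree≥ c φ φ-injective nb = neighbours (λ i → proj₁ (nb i)) injective (λ i → proj₁ (proj₂ (nb i)))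
  where
  injective : Injective _≡_ _≡_ (λ i → proj₁ (nb i))
  injective {i} {j} eq = φ-injective (begin
    φ i                 ≡⟨ ≡.sym (proj₂ (proj₂ (nb i))) ⟩
    c (proj₁ (nb i))    ≡⟨ cong c eq ⟩
    c (proj₁ (nb j))    ≡⟨ proj₂ (proj₂ (nb j)) ⟩
    φ j                 ∎)
    where open ≡-Reasoning

module _ {G : Graph} where

  grundy≤1+Δ : ∀ {Δ} → MaxDegreeAtMost (E G) Δ → ∀ m → HasGrundyColoring G m → m ≤ suc Δ
  grundy≤1+Δ Δ-bound zero    _            = z≤n
  grundy≤1+Δ Δ-bound (suc r) (c , grundy) =
    s≤s (Δ-bound top (colourful⇒degree≥ (col c) inject₁ inject₁-injective lower))
    where
    top : Fin (V G)
    top = proj₁ (onto c (fromℕ r))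
    lower : ∀ i → ∃[ u ] (E G top u × col c u ≡ inject₁ i)
    lower i = grundy (inject₁ i) (fromℕ r) (≤∧≢⇒< (≤fromℕ _) (fromℕ≢inject₁ ∘ ≡.sym)) top
                     (proj₂ (onto c (fromℕ r)) refl)

  b≤1+Δ : ∀ {Δ} → MaxDegreeAtMost (E G) Δ → ∀ m → HasBColoring G m → m ≤ suc Δ
  b≤1+Δ Δ-bound zero    _       = z≤n
  b≤1+Δ Δ-bound (suc r) (c , b) =
    s≤s (Δ-bound (proj₁ (b zero))
      (colourful⇒degree≥ (col c) suc suc-injective λ i → proj₂ (proj₂ (b zero)) (suc i) λ ()))

  clique⇒χ≥ : (f : Fin k → Fin (V G)) → (∀ {i j} → i ≢ j → E G (f i) (f j)) → ∀ m → Coloring G m → k ≤ m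
  clique⇒χ≥ f clique m c = injective⇒≤ injective
    where
    injective : Injective _≡_ _≡_ (col c ∘ f)
    injective {i} {j} eq with i ≟ j
    ... | yes i≡j = i≡j
    ... | no  i≢j = ⊥-elim (proper c (clique i≢j) eq)

  zColouring⇒denseStar : (c : Coloring G (suc r)) → IsZColoring G c → ∃[ v ] DenseStar (E G) r v
  zColouring⇒denseStar {r} c (_ , u , u-colour , u-adjacent , u-neighbour) =
    u last , degree last , colourful⇒degree≥ (col c) (punchIn last) (punchIn-injective last _ _) dense
    where
    last : Fin (suc r)
    last = fromℕ r
    degree : ∀ j → DegreeAtLeast (E G) r (u j)
    degree j = colourful⇒degree≥ (col c) (punchIn j) (punchIn-injective j _ _)
                 λ i → u-neighbour (punchIn j i) j (punchInᵢ≢i j i)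
    dense : ∀ i → ∃[ v ] ((E G (u last) v × DegreeAtLeast (E G) r v) × col c v ≡ punchIn last i)
    dense i = u (punchIn last i) , (u-adjacent _ (punchInᵢ≢i last i) , degree _) , u-colour _

  z≤ : DenseStarFree (E G) k → ∀ m → HasZColoring G m → m ≤ k
  z≤ free zero    ()
  z≤ {k} free (suc r) (c , z) with suc r ≤? k | zColouring⇒denseStar c z
  ... | yes r<k | _        = r<k
  ... | no  r≮k | v , star = ⊥-elim (free v (DenseStar-weaken (s≤s⁻¹ (≰⇒> r≮k)) star))

  clique⇒zColouring : (c : Coloring G (suc m)) → GrundyCond G c → (f : Fin (suc m) → Fin (V G)) →
    (∀ j → col c (f j) ≡ j) → (∀ {i j} → i ≢ j → E G (f i) (f j)) → IsZColoring G c
  clique⇒zColouring c grundy f f-colour clique =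
    grundy , f , f-colour , (λ j j≢last → clique (j≢last ∘ ≡.sym)) ,
    λ i j i≢j → f i , clique (i≢j ∘ ≡.sym) , f-colour i

module Enumerated {A : Set} {N : ℕ} (enumeration : Fin N ↔ A) (Adj : A → A → Set)
                  (Adj-sym : ∀ {a b} → Adj a b → Adj b a) (Adj-irrefl : ∀ {a} → ¬ Adj a a) where

  open Inverse enumeration

  graph : Graph
  graph = record { V = N ; E = λ u v → Adj (to u) (to v) ; sym = Adj-sym ; irrefl = Adj-irrefl }

  to-injective : Injective _≡_ _≡_ to
  to-injective {u} {v} eq = begin
    u              ≡⟨ ≡.sym (strictlyInverseʳ u) ⟩
    from (to u)    ≡⟨ cong from eq ⟩
    from (to v)    ≡⟨ strictlyInverseʳ v ⟩
    v              ∎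
    where open ≡-Reasoning

  adjacent-from : ∀ {a b} → Adj a b → E graph (from a) (from b)
  adjacent-from {a} {b} = ≡.subst₂ Adj (≡.sym (strictlyInverseˡ a)) (≡.sym (strictlyInverseˡ b))

  maxDegree-from : ∀ {Δ} → MaxDegreeAtMost Adj Δ → MaxDegreeAtMost (E graph) Δ
  maxDegree-from Δ-bound v = Δ-bound (to v) ∘ DegreeAtLeast-map to to-injective id

  denseStarFree-from : DenseStarFree Adj k → DenseStarFree (E graph) k
  denseStarFree-from free v = free (to v) ∘ DenseStar-map to to-injective id

  module _ {m} (c : A → Fin m) where

    IsGrundy : Set
    IsGrundy = ∀ (i j : Fin m) → toℕ i < toℕ j → ∀ a → c a ≡ j → ∃[ b ] (Adj a b × c b ≡ i)

    IsBVertex : Fin m → A → Set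
    IsBVertex i a = c a ≡ i × (∀ j → j ≢ i → ∃[ b ] (Adj a b × c b ≡ j))

    colour-from : ∀ {a i} → c a ≡ i → c (to (from a)) ≡ i
    colour-from {a} = trans (cong c (strictlyInverseˡ a))

    neighbour-from : ∀ {a i} → ∃[ b ] (Adj a b × c b ≡ i) → ∃[ u ] (Adj a (to u) × c (to u) ≡ i)
    neighbour-from (b , a∼b , cb≡i) = from b , subst (Adj _) (≡.sym (strictlyInverseˡ b)) a∼b , colour-from cb≡i

    module _ (proper : ∀ {a b} → Adj a b → c a ≢ c b) (surjective : ∀ i → ∃[ a ] c a ≡ i) where

      colouring : Coloring graph m
      colouring = record
        { col    = c ∘ to
        ; proper = proper
        ; onto   = λ i → from (proj₁ (surjective i)) , λ { refl → colour-from (proj₂ (surjective i)) }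
        }

      grundy-from : IsGrundy → IsGrundyColoring graph colouring
      grundy-from grundy i j i<j v = neighbour-from ∘ grundy i j i<j (to v)

      b-from : (∀ i → ∃[ a ] IsBVertex i a) → IsBColoring graph colouring
      b-from bVertex i with bVertex i
      ... | a , a-bVertex with subst (IsBVertex i) (≡.sym (strictlyInverseˡ a)) a-bVertex
      ... | colour , others = from a , colour , λ j j≢i → neighbour-from (others j j≢i)

below-inject≤ : (i : Fin m) (j : Fin k) .(k≤m : k ≤ m) → toℕ i < toℕ (inject≤ j k≤m) →
  ∃[ j′ ] (toℕ j′ < toℕ j × inject≤ j′ k≤m ≡ i)
below-inject≤ i j k≤m i<j = fromℕ< i<k , subst (_< toℕ j) (≡.sym (toℕ-fromℕ< i<k)) i<j′ ,
  toℕ-injective (trans (toℕ-inject≤ _ k≤m) (toℕ-fromℕ< i<k))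
  where
  i<j′ : toℕ i < toℕ j
  i<j′ = subst (toℕ i <_) (toℕ-inject≤ j k≤m) i<j
  i<k : toℕ i < _
  i<k = <-trans i<j′ (toℕ<n j)

2^↔Vec : ∀ d → Fin (2 ^ d) ↔ Vec Bool d
2^↔Vec zero    = mk↔ₛ′ (λ _ → []) (λ _ → zero) (λ { [] → refl }) (λ { zero → refl })
2^↔Vec (suc d) = ↔-trans *↔× (↔-trans (2↔Bool ×-↔ 2^↔Vec d) cons↔)
  where
  cons↔ : (Bool × Vec Bool d) ↔ Vec Bool (suc d)
  cons↔ = mk↔ₛ′ (uncurry _∷_) uncons (λ { (_ ∷ _) → refl }) (λ _ → refl)

-- The binomial tree B_d: x ∼ᴮ y when y is x with one bit flipped and every bit before it is false.
infix 4 _∼ᴮ_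
data _∼ᴮ_ : Vec Bool d → Vec Bool d → Set where
  flip₀ : (p : Vec Bool d) → false ∷ p ∼ᴮ true ∷ p
  flip₁ : (p : Vec Bool d) → true ∷ p ∼ᴮ false ∷ p
  0∷_   : {x y : Vec Bool d} → x ∼ᴮ y → false ∷ x ∼ᴮ false ∷ y

∼ᴮ-sym : {x y : Vec Bool d} → x ∼ᴮ y → y ∼ᴮ x
∼ᴮ-sym (flip₀ p) = flip₁ p
∼ᴮ-sym (flip₁ p) = flip₀ p
∼ᴮ-sym (0∷ e)    = 0∷ ∼ᴮ-sym e

∼ᴮ-irrefl : {x : Vec Bool d} → ¬ x ∼ᴮ x
∼ᴮ-irrefl (0∷ e) = ∼ᴮ-irrefl e

flipPosition : {x y : Vec Bool d} → x ∼ᴮ y → Fin d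
flipPosition (flip₀ _) = zero
flipPosition (flip₁ _) = zero
flipPosition (0∷ e)    = suc (flipPosition e)

flipPosition-injective : {x y y′ : Vec Bool d} (e : x ∼ᴮ y) (e′ : x ∼ᴮ y′) →
  flipPosition e ≡ flipPosition e′ → y ≡ y′
flipPosition-injective (flip₀ _) (flip₀ _) _  = refl
flipPosition-injective (flip₁ _) (flip₁ _) _  = refl
flipPosition-injective (0∷ e)    (0∷ e′)   eq = cong (false ∷_) (flipPosition-injective e e′ (suc-injective eq))

leadingZeros : Vec Bool d → Fin (suc d)
leadingZeros []          = zero
leadingZeros (true ∷ _)  = zero
leadingZeros (false ∷ x) = suc (leadingZeros x)

flipPosition≤leadingZeros : {x y : Vec Bool d} (e : x ∼ᴮ y) → toℕ (flipPosition e) ≤ toℕ (leadingZeros x)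
flipPosition≤leadingZeros (flip₀ _) = z≤n
flipPosition≤leadingZeros (flip₁ _) = z≤n
flipPosition≤leadingZeros (0∷ e)    = s≤s (flipPosition≤leadingZeros e)

leadingZeros-flipPosition : {x y : Vec Bool d} (e : x ∼ᴮ y) → toℕ (flipPosition e) < toℕ (leadingZeros x) →
  toℕ (leadingZeros y) ≡ toℕ (flipPosition e)
leadingZeros-flipPosition (flip₀ _) _   = refl
leadingZeros-flipPosition (0∷ e)    e<x = cong suc (leadingZeros-flipPosition e (s≤s⁻¹ e<x))

leadingZeros-proper : {x y : Vec Bool d} → x ∼ᴮ y → leadingZeros x ≢ leadingZeros y
leadingZeros-proper (flip₀ _) ()
leadingZeros-proper (flip₁ _) ()
leadingZeros-proper (0∷ e)    eq = leadingZeros-proper e (suc-injective eq)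

leadingZeros-grundy : ∀ x (i : Fin (suc d)) → toℕ i < toℕ (leadingZeros x) →
  ∃[ y ] (x ∼ᴮ y × leadingZeros y ≡ i)
leadingZeros-grundy (false ∷ x) zero    _   = true ∷ x , flip₀ x , refl
leadingZeros-grundy (false ∷ x) (suc i) i<x with leadingZeros-grundy x i (s≤s⁻¹ i<x)
... | y , x∼y , y≡i = false ∷ y , 0∷ x∼y , cong suc y≡i

leadingZeros-surjective : ∀ (i : Fin (suc d)) → ∃[ x ] leadingZeros x ≡ i
leadingZeros-surjective {zero}  zero    = [] , refl
leadingZeros-surjective {suc d} zero    = true ∷ proj₁ (leadingZeros-surjective {d} zero) , refl
leadingZeros-surjective {suc d} (suc i) with leadingZeros-surjective i
... | x , x≡i = false ∷ x , cong suc x≡i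

parity : Vec Bool d → Bool
parity []      = false
parity (b ∷ x) = b xor parity x

parity-proper : {x y : Vec Bool d} → x ∼ᴮ y → parity x ≢ parity y
parity-proper (flip₀ p) = not-¬ refl
parity-proper (flip₁ p) = not-¬ refl ∘ ≡.sym
parity-proper (0∷ e)    = parity-proper e

flipHead : Vec Bool (suc d) → Vec Bool (suc d)
flipHead (b ∷ p) = not b ∷ p

∼ᴮ-flipHead : ∀ (x : Vec Bool (suc d)) → x ∼ᴮ flipHead x
∼ᴮ-flipHead (false ∷ p) = flip₀ p
∼ᴮ-flipHead (true ∷ p)  = flip₁ p

parity-flipHead : ∀ (x : Vec Bool (suc d)) → parity (flipHead x) ≡ not (parity x)
parity-flipHead (false ∷ p) = refl
parity-flipHead (true ∷ p)  = ≡.sym (not-involutive (parity p))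

module Construction (q e : ℕ) (e≤q : e ≤ q) where

  n D : ℕ
  n = 2 + q
  D = n + e

  Vertex : Set
  Vertex = Fin n ⊎ Vec Bool D ⊎ Fin (suc D) × Fin (suc D)

  pattern clq i      = inj₁ i
  pattern node x     = inj₂ (inj₁ x)
  pattern centre c   = inj₂ (inj₂ (c , zero))
  pattern leaf c j   = inj₂ (inj₂ (c , suc j))

  data Adj : Vertex → Vertex → Set where
    clique : ∀ {i j} → i ≢ j → Adj (clq i) (clq j)
    tree   : ∀ {x y} → x ∼ᴮ y → Adj (node x) (node y)
    spoke  : ∀ c j → Adj (centre c) (leaf c j)
    spoke⁻ : ∀ c j → Adj (leaf c j) (centre c)

  Adj-sym : ∀ {a b} → Adj a b → Adj b a
  Adj-sym (clique i≢j) = clique (i≢j ∘ ≡.sym)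
  Adj-sym (tree e)     = tree (∼ᴮ-sym e)
  Adj-sym (spoke c j)  = spoke⁻ c j
  Adj-sym (spoke⁻ c j) = spoke c j

  Adj-irrefl : ∀ {a} → ¬ Adj a a
  Adj-irrefl (clique i≢i) = i≢i refl
  Adj-irrefl (tree e)     = ∼ᴮ-irrefl e

  enumeration : Fin (n + (2 ^ D + suc D * suc D)) ↔ Vertex
  enumeration = ↔-trans +↔⊎ (↔-refl ⊎-↔ ↔-trans +↔⊎ (2^↔Vec D ⊎-↔ *↔×))

  1+q≤D : suc q ≤ D
  1+q≤D = s≤s (m≤n⇒m≤1+n (m≤m+n q e))

  label : ∀ {a b} → Adj a b → ℕ
  label (clique i≢j) = toℕ (punchOut i≢j)
  label (tree e)     = toℕ (flipPosition e)
  label (spoke c j)  = toℕ j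
  label (spoke⁻ c j) = 0

  label-injective : ∀ {a b b′} (e : Adj a b) (e′ : Adj a b′) → label e ≡ label e′ → b ≡ b′
  label-injective (clique i≢j) (clique i≢j′) = cong clq ∘ punchOut-injective i≢j i≢j′ ∘ toℕ-injective
  label-injective (tree e)     (tree e′)     = cong node ∘ flipPosition-injective e e′ ∘ toℕ-injective
  label-injective (spoke c j)  (spoke c j′)  = cong (leaf c) ∘ toℕ-injective
  label-injective (spoke⁻ c j) (spoke⁻ c j)  = λ _ → refl

  label<D : ∀ {a b} (e : Adj a b) → label e < D
  label<D (clique i≢j) = <-≤-trans (toℕ<n (punchOut i≢j)) 1+q≤D
  label<D (tree e)     = toℕ<n (flipPosition e)
  label<D (spoke c j)  = toℕ<n j
  label<D (spoke⁻ c j) = s≤s z≤n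

  degree≤ : ∀ {a b} → (∀ {a′} (e : Adj a a′) → label e < b) → DegreeAtLeast Adj r a → r ≤ b
  degree≤ bound = labels⇒degree≤ {a = 0} label label-injective λ e → z≤n , bound e

  maxDegree : MaxDegreeAtMost Adj D
  maxDegree _ = degree≤ label<D

  clique-degree : ∀ {i} → DegreeAtLeast Adj r (clq i) → r ≤ suc q
  clique-degree = degree≤ λ { (clique i≢j) → toℕ<n (punchOut i≢j) }

  node-degree : ∀ {x} → DegreeAtLeast Adj r (node x) → r ≤ suc (toℕ (leadingZeros x))
  node-degree = degree≤ λ { (tree e) → s≤s (flipPosition≤leadingZeros e) }

  leaf-degree : ∀ {c j} → DegreeAtLeast Adj r (leaf c j) → r ≤ 1
  leaf-degree = degree≤ λ { (spoke⁻ c j) → s≤s z≤n }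

  n≰1 : ¬ n ≤ 1
  n≰1 (s≤s ())

  D∸[1+q]<n : D ∸ suc q < n
  D∸[1+q]<n = s≤s (≤-trans (m≤n+o⇒m∸n≤o D (suc q) (s≤s (≤-reflexive (≡.sym (+-suc q e))))) (s≤s e≤q))

  DenseNeighbours : ℕ → Vertex → Set
  DenseNeighbours = DegreeAtLeast (λ a b → Adj a b × DegreeAtLeast Adj n b)

  node-denseNeighbours≤ : ∀ {x} → DegreeAtLeast Adj n (node x) → DenseNeighbours r (node x) → r ≤ D ∸ suc q
  node-denseNeighbours≤ {x = x} dense-x =
    labels⇒degree≤ (label ∘ proj₁) (λ e e′ → label-injective (proj₁ e) (proj₁ e′))
      λ { (tree e , dense-y) → deep e dense-y , label<D (tree e) }
    where
    deep : ∀ {y} (e : x ∼ᴮ y) → DegreeAtLeast Adj n (node y) → suc q ≤ toℕ (flipPosition e)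
    deep e dense-y with toℕ (flipPosition e) <? toℕ (leadingZeros x)
    ... | yes e<x = ≤-trans (s≤s⁻¹ (node-degree dense-y)) (≤-reflexive (leadingZeros-flipPosition e e<x))
    ... | no  e≮x = ≤-trans (s≤s⁻¹ (node-degree dense-x)) (≮⇒≥ e≮x)

  centre-neighbour-sparse : ∀ {c b} → Adj (centre c) b → ¬ DegreeAtLeast Adj n b
  centre-neighbour-sparse (spoke c j) = n≰1 ∘ leaf-degree

  denseStarFree : DenseStarFree Adj n
  denseStarFree (clq i)    (degree , _)     = 1+n≰n (clique-degree degree)
  denseStarFree (node x)   (degree , dense) = <⇒≱ D∸[1+q]<n (node-denseNeighbours≤ degree dense)
  denseStarFree (centre c) (_ , dense)      = uncurry centre-neighbour-sparse (DegreeAtLeast.adjacent dense zero)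
  denseStarFree (leaf c j) (degree , _)     = n≰1 (leaf-degree degree)

  open Enumerated enumeration Adj Adj-sym Adj-irrefl public

  n≤1+D : n ≤ suc D
  n≤1+D = m≤n⇒m≤1+n (m≤m+n n e)

  grundyColour : Vertex → Fin (suc D)
  grundyColour (clq i)    = inject≤ i n≤1+D
  grundyColour (node x)   = leadingZeros x
  grundyColour (centre _) = suc zero
  grundyColour (leaf _ _) = zero

  grundyColour-proper : ∀ {a b} → Adj a b → grundyColour a ≢ grundyColour b
  grundyColour-proper (clique i≢j) = i≢j ∘ inject≤-injective _ _ _ _
  grundyColour-proper (tree e)     = leadingZeros-proper e
  grundyColour-proper (spoke c j)  = λ ()
  grundyColour-proper (spoke⁻ c j) = λ ()

  grundyColour-surjective : ∀ i → ∃[ a ] grundyColour a ≡ i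
  grundyColour-surjective i = node (proj₁ (leadingZeros-surjective i)) , proj₂ (leadingZeros-surjective i)

  grundyColour-grundy : IsGrundy grundyColour
  grundyColour-grundy i _ i<j (clq i′) refl =
    let i″ , i″<i′ , i″≡i = below-inject≤ i i′ n≤1+D i<j
    in  clq i″ , clique (<⇒≢ i″<i′ ∘ cong toℕ ∘ ≡.sym) , i″≡i
  grundyColour-grundy i _ i<j (node x) refl =
    let y , x∼y , y≡i = leadingZeros-grundy x i i<j in node y , tree x∼y , y≡i
  grundyColour-grundy zero _ _ (centre c) refl = leaf c zero , spoke c zero , refl
  grundyColour-grundy (suc _) _ (s≤s ()) (centre c) refl
  grundyColour-grundy _ _ () (leaf _ _) refl

  bColour : Vertex → Fin (suc D)
  bColour (clq i)    = inject≤ i n≤1+D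
  bColour (node x)   = leadingZeros x
  bColour (centre c) = c
  bColour (leaf c j) = punchIn c j

  bColour-proper : ∀ {a b} → Adj a b → bColour a ≢ bColour b
  bColour-proper (clique i≢j) = i≢j ∘ inject≤-injective _ _ _ _
  bColour-proper (tree e)     = leadingZeros-proper e
  bColour-proper (spoke c j)  = punchInᵢ≢i c j ∘ ≡.sym
  bColour-proper (spoke⁻ c j) = punchInᵢ≢i c j

  bColour-bVertex : ∀ i → IsBVertex bColour i (centre i)
  bColour-bVertex i = refl , λ j j≢i →
    leaf i (punchOut (j≢i ∘ ≡.sym)) , spoke i _ , punchIn-punchOut (j≢i ∘ ≡.sym)

  bit : Bool → Fin n
  bit false = zero
  bit true  = suc zero

  bit-injective : Injective _≡_ _≡_ bit
  bit-injective {false} {false} _ = refl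
  bit-injective {true}  {true}  _ = refl

  parityColour : Vertex → Fin n
  parityColour (clq i)    = i
  parityColour (node x)   = bit (parity x)
  parityColour (centre _) = suc zero
  parityColour (leaf _ _) = zero

  parityColour-proper : ∀ {a b} → Adj a b → parityColour a ≢ parityColour b
  parityColour-proper (clique i≢j) = i≢j
  parityColour-proper (tree e)     = parity-proper e ∘ bit-injective
  parityColour-proper (spoke c j)  = λ ()
  parityColour-proper (spoke⁻ c j) = λ ()

  parityColour-grundy : IsGrundy parityColour
  parityColour-grundy i _ i<j (clq i′) refl = clq i , clique (<⇒≢ i<j ∘ cong toℕ ∘ ≡.sym) , refl
  parityColour-grundy i j i<j (node x) x≡j with parity x in x-odd
  parityColour-grundy zero    _ _        (node x) refl | true =
    node (flipHead x) , tree (∼ᴮ-flipHead x) , cong bit (trans (parity-flipHead x) (cong not x-odd))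
  parityColour-grundy (suc _) _ (s≤s ()) (node x) refl | true
  parityColour-grundy _       _ ()       (node x) refl | false
  parityColour-grundy zero    _ _        (centre c) refl = leaf c zero , spoke c zero , refl
  parityColour-grundy (suc _) _ (s≤s ()) (centre c) refl
  parityColour-grundy _       _ ()       (leaf _ _) refl

  parityColouring : Coloring graph n
  parityColouring = colouring parityColour parityColour-proper λ i → clq i , refl

  Γ≡1+D : Γ≡ graph (suc D)
  Γ≡1+D = (colouring grundyColour grundyColour-proper grundyColour-surjective ,
             grundy-from grundyColour grundyColour-proper grundyColour-surjective grundyColour-grundy) ,
            grundy≤1+Δ (maxDegree-from maxDegree)

  b≡1+D : b≡ graph (suc D)
  b≡1+D = (colouring bColour bColour-proper (λ i → centre i , refl) ,
             b-from bColour bColour-proper (λ i → centre i , refl) (λ i → centre i , bColour-bVertex i)) ,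
            b≤1+Δ (maxDegree-from maxDegree)

  z≡n : z≡ graph n
  z≡n = (parityColouring ,
             clique⇒zColouring parityColouring
               (grundy-from parityColour parityColour-proper (λ i → clq i , refl) parityColour-grundy)
               (Inverse.from enumeration ∘ clq) (λ j → colour-from parityColour {clq j} refl) (adjacent-from ∘ clique)) ,
            z≤ (denseStarFree-from denseStarFree)

  χ≡n : χ≡ graph n
  χ≡n = parityColouring , clique⇒χ≥ (Inverse.from enumeration ∘ clq) (adjacent-from ∘ clique)

family : ℕ → Graph
family n = Construction.graph (n ∸ 2) (n ∸ 2) ≤-refl

2[2+q]∸1≡3+q+q : ∀ q → 2 * (2 + q) ∸ 1 ≡ suc (2 + q + q)
2[2+q]∸1≡3+q+q q rewrite +-suc q (suc (q + 0)) | +-suc q (q + 0) | +-identityʳ q = refl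

proposition2 : Σ (ℕ → Graph) λ G → ∀ n → 3 ≤ n →
    Γ≡ (G n) (2 * n ∸ 1) × b≡ (G n) (2 * n ∸ 1) × z≡ (G n) n × χ≡ (G n) n
proposition2 = family , λ where
  (suc (suc (suc p))) (s≤s (s≤s (s≤s _))) → let open Construction (suc p) (suc p) ≤-refl in
    subst (Γ≡ graph) (≡.sym (2[2+q]∸1≡3+q+q (suc p))) Γ≡1+D ,
    subst (b≡ graph) (≡.sym (2[2+q]∸1≡3+q+q (suc p))) b≡1+D ,
    z≡n ,
    χ≡n
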